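{- Let $\mathcal D$ be any family of dependency notions and let $\varphi\in\mathbf{FO}(\mathcal D,[\cdot])$. Then $\varphi$ is logically equivalent to some formula of the form $\bigwedge_i[\theta_i]\wedge\psi$, where the $\theta_i$ are first-order sentences and $\psi\in\mathbf{FO}(\mathcal D)$.
   Context: Team semantics (lax version). Let $\mathfrak M$ be a structure with domain $M$. A team $X$ is a set of assignments $s: V\to M$ on a common domain $V$; $X(\bar v)=\{s(\bar v): s\in X\}$. First-order parts of formulas are in negation normal form. Satisfaction: literal $\alpha$: every $s\in X$ satisfies $\alpha$ (Tarski); $\psi\vee\theta$: $X=Y\cup Z$ with $\mathfrak M\models_Y\psi$, $\mathfrak M\models_Z\theta$; $\wedge$: both; $\exists v\psi$: some $F: X\to\mathcal P(M)\setminus\{\emptyset\}$ with $\mathfrak M\models_{X[F/v]}\psi$, $X[F/v]=\{s[m/v]: s\in X,m\in F(s)\}$; $\forall v\psi$: $\mathfrak M\models_{X[M/v]}\psi$, $X[M/v]=\{s[m/v]: s\in X,m\in M\}$. For a first-order sentence $\theta$ in the signature of $\mathfrak M$, $\mathfrak M\models_X[\theta]$ iff $\mathfrak M\models\theta$ (Tarski). A dependency notion $\mathbf D$ of arity $k$ is an isomorphism-closed class of structures $(M,R)$ with $R$ $k$-ary; $\mathfrak M\models_X\mathbf D\bar v$ iff $(M,X(\bar v))\in\mathbf D$. Two formulas are equivalent if satisfied by the same teams in every structure. -}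

module Defs where

open import Data.Nat using (ℕ; _≟_)
open import Data.Bool using (Bool; true; false)
open import Data.Vec using (Vec; []; _∷_; map)
open import Data.List using (List; foldr)
open import Data.Product using (Σ; ∃; _×_; _,_)
open import Data.Sum using (_⊎_)
open import Data.Empty using (⊥)
open import Relation.Nullary using (¬_; yes; no)
open import Relation.Binary.PropositionalEquality using (_≡_; _≢_)
open import Function.Bundles using (_↔_; _⇔_; Inverse)
open import Level using (Level; suc; zero)

record Signature : Set₁ where
  field
    Rel    : Set
    relAr  : Rel → ℕ
    Fun    : Set
    funAr  : Fun → ℕ
open Signature public

Var : Set
Var = ℕ

data Term (L : Signature) : Set where
  var : Var → Term L
  app : (f : Fun L) → Vec (Term L) (funAr L f) → Term L

record Structure (L : Signature) : Set₁ where
  field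
    Dom    : Set
    point  : Dom      -- domains of structures are nonempty
    relI   : (R : Rel L) → Vec Dom (relAr L R) → Set
    funI   : (f : Fun L) → Vec Dom (funAr L f) → Dom
open Structure public

Assignment : ∀ {L} → Structure L → Set
Assignment 𝔐 = Var → Dom 𝔐

update : ∀ {A : Set} → (Var → A) → Var → A → (Var → A)
update s v m w with w ≟ v
... | yes _ = m
... | no  _ = s w

mutual
  evalT : ∀ {L} (𝔐 : Structure L) → Assignment 𝔐 → Term L → Dom 𝔐
  evalT 𝔐 s (var v)    = s v
  evalT 𝔐 s (app f ts) = funI 𝔐 f (evalTs 𝔐 s ts)

  evalTs : ∀ {L} (𝔐 : Structure L) → Assignment 𝔐 → ∀ {n} → Vec (Term L) n → Vec (Dom 𝔐) n
  evalTs 𝔐 s []       = []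
  evalTs 𝔐 s (t ∷ ts) = evalT 𝔐 s t ∷ evalTs 𝔐 s ts

mutual
  data OccT {L} (v : Var) : Term L → Set where
    occ-var : OccT v (var v)
    occ-app : ∀ {f ts} → OccTs v ts → OccT v (app f ts)

  data OccTs {L} (v : Var) : ∀ {n} → Vec (Term L) n → Set where
    here  : ∀ {n t} {ts : Vec (Term L) n} → OccT v t → OccTs v (t ∷ ts)
    there : ∀ {n t} {ts : Vec (Term L) n} → OccTs v ts → OccTs v (t ∷ ts)

data Literal (L : Signature) : Set where
  rel  : (R : Rel L) → Vec (Term L) (relAr L R) → Literal L
  nrel : (R : Rel L) → Vec (Term L) (relAr L R) → Literal L
  eq   : Term L → Term L → Literal L
  neq  : Term L → Term L → Literal L

SatLit : ∀ {L} (𝔐 : Structure L) → Assignment 𝔐 → Literal L → Set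
SatLit 𝔐 s (rel R ts)  = relI 𝔐 R (evalTs 𝔐 s ts)
SatLit 𝔐 s (nrel R ts) = ¬ relI 𝔐 R (evalTs 𝔐 s ts)
SatLit 𝔐 s (eq t u)    = evalT 𝔐 s t ≡ evalT 𝔐 s u
SatLit 𝔐 s (neq t u)   = evalT 𝔐 s t ≢ evalT 𝔐 s u

data OccLit {L} (v : Var) : Literal L → Set where
  o-rel   : ∀ {R ts} → OccTs v ts → OccLit v (rel R ts)
  o-nrel  : ∀ {R ts} → OccTs v ts → OccLit v (nrel R ts)
  o-eqˡ   : ∀ {t u} → OccT v t → OccLit v (eq t u)
  o-eqʳ   : ∀ {t u} → OccT v u → OccLit v (eq t u)
  o-neqˡ  : ∀ {t u} → OccT v t → OccLit v (neq t u)
  o-neqʳ  : ∀ {t u} → OccT v u → OccLit v (neq t u)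

data FOF (L : Signature) : Set where
  lit  : Literal L → FOF L
  _∧_  : FOF L → FOF L → FOF L
  _∨_  : FOF L → FOF L → FOF L
  ex   : Var → FOF L → FOF L
  all  : Var → FOF L → FOF L

Tarski : ∀ {L} (𝔐 : Structure L) → Assignment 𝔐 → FOF L → Set
Tarski 𝔐 s (lit α)   = SatLit 𝔐 s α
Tarski 𝔐 s (φ ∧ ψ)   = Tarski 𝔐 s φ × Tarski 𝔐 s ψ
Tarski 𝔐 s (φ ∨ ψ)   = Tarski 𝔐 s φ ⊎ Tarski 𝔐 s ψ
Tarski 𝔐 s (ex v φ)  = Σ (Dom 𝔐) λ m → Tarski 𝔐 (update s v m) φ
Tarski 𝔐 s (all v φ) = (m : Dom 𝔐) → Tarski 𝔐 (update s v m) φ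

data FreeIn {L} (v : Var) : FOF L → Set where
  f-lit  : ∀ {α} → OccLit v α → FreeIn v (lit α)
  f-∧ˡ   : ∀ {φ ψ} → FreeIn v φ → FreeIn v (φ ∧ ψ)
  f-∧ʳ   : ∀ {φ ψ} → FreeIn v ψ → FreeIn v (φ ∧ ψ)
  f-∨ˡ   : ∀ {φ ψ} → FreeIn v φ → FreeIn v (φ ∨ ψ)
  f-∨ʳ   : ∀ {φ ψ} → FreeIn v ψ → FreeIn v (φ ∨ ψ)
  f-ex   : ∀ {w φ} → v ≢ w → FreeIn v φ → FreeIn v (ex w φ)
  f-all  : ∀ {w φ} → v ≢ w → FreeIn v φ → FreeIn v (all w φ)

IsSentence : ∀ {L} → FOF L → Set
IsSentence θ = ∀ v → ¬ FreeIn v θ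

FOSentence : Signature → Set
FOSentence L = Σ (FOF L) IsSentence

-- 𝔐 ⊨ θ for a sentence (Tarski); the assignment is irrelevant
Models : ∀ {L} (𝔐 : Structure L) → FOF L → Set
Models 𝔐 θ = (s : Assignment 𝔐) → Tarski 𝔐 s θ

record DependencyNotion (k : ℕ) : Set₁ where
  field
    holds      : (M : Set) → (Vec M k → Set) → Set
    iso-closed : ∀ {M N : Set} (f : M ↔ N)
                   (R : Vec M k → Set) (R' : Vec N k → Set) →
                   (∀ a → R a ⇔ R' (map (Inverse.to f) a)) →
                   holds M R → holds N R'
open DependencyNotion public

record DepFamily : Set₁ where
  field
    Idx    : Set
    arity  : Idx → ℕ
    notion : (i : Idx) → DependencyNotion (arity i)
open DepFamily public

-- Formulas of FO(𝒟) (index false) and FO(𝒟,[·]) (index true)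

data Form (L : Signature) (𝒟 : DepFamily) : Bool → Set where
  lit  : ∀ {b} → Literal L → Form L 𝒟 b
  _∧_  : ∀ {b} → Form L 𝒟 b → Form L 𝒟 b → Form L 𝒟 b
  _∨_  : ∀ {b} → Form L 𝒟 b → Form L 𝒟 b → Form L 𝒟 b
  ex   : ∀ {b} → Var → Form L 𝒟 b → Form L 𝒟 b
  all  : ∀ {b} → Var → Form L 𝒟 b → Form L 𝒟 b
  dep  : ∀ {b} (i : Idx 𝒟) → Vec Var (arity 𝒟 i) → Form L 𝒟 b
  box  : (θ : FOF L) → IsSentence θ → Form L 𝒟 true

embed : ∀ {L 𝒟} → Form L 𝒟 false → Form L 𝒟 true
embed (lit α)   = lit α
embed (φ ∧ ψ)   = embed φ ∧ embed ψ
embed (φ ∨ ψ)   = embed φ ∨ embed ψ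
embed (ex v φ)  = ex v (embed φ)
embed (all v φ) = all v (embed φ)
embed (dep i vs) = dep i vs

-- ⋀_i [θ_i] ∧ ψ   (for the empty list this is just ψ)
normalForm : ∀ {L 𝒟} → List (FOSentence L) → Form L 𝒟 false → Form L 𝒟 true
normalForm θs ψ = foldr (λ { (θ , c) acc → box θ c ∧ acc }) (embed ψ) θs

-- Team semantics (lax)

Team : ∀ {L} → Structure L → Set₁
Team 𝔐 = Assignment 𝔐 → Set

_≐_ : ∀ {A : Set} → (Var → A) → (Var → A) → Set
s ≐ t = ∀ v → s v ≡ t v

IsUnion : ∀ {L} {𝔐 : Structure L} → Team 𝔐 → Team 𝔐 → Team 𝔐 → Set
IsUnion X Y Z = ∀ s → X s ⇔ (Y s ⊎ Z s)

supp : ∀ {L} {𝔐 : Structure L} → Team 𝔐 → Var → (Assignment 𝔐 → Dom 𝔐 → Set) → Team 𝔐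
supp {𝔐 = 𝔐} X v F t = Σ (Assignment 𝔐) λ s → X s × Σ (Dom 𝔐) λ m → F s m × (t ≐ update s v m)

dupl : ∀ {L} {𝔐 : Structure L} → Team 𝔐 → Var → Team 𝔐
dupl {𝔐 = 𝔐} X v t = Σ (Assignment 𝔐) λ s → X s × Σ (Dom 𝔐) λ m → (t ≐ update s v m)

proj : ∀ {L} {𝔐 : Structure L} → Team 𝔐 → ∀ {k} → Vec Var k → Vec (Dom 𝔐) k → Set
proj {𝔐 = 𝔐} X vs a = Σ (Assignment 𝔐) λ s → X s × (map s vs ≡ a)

Sat : ∀ {L 𝒟 b} (𝔐 : Structure L) → Team 𝔐 → Form L 𝒟 b → Set₁
Sat 𝔐 X (lit α)   = Level.Lift (suc zero) (∀ s → X s → SatLit 𝔐 s α)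
Sat 𝔐 X (φ ∧ ψ)   = Sat 𝔐 X φ × Sat 𝔐 X ψ
Sat 𝔐 X (φ ∨ ψ)   = Σ (Team 𝔐) λ Y → Σ (Team 𝔐) λ Z →
                      Level.Lift (suc zero) (IsUnion {𝔐 = 𝔐} X Y Z) × Sat 𝔐 Y φ × Sat 𝔐 Z ψ
Sat 𝔐 X (ex v φ)  = Σ (Assignment 𝔐 → Dom 𝔐 → Set) λ F →
                      Level.Lift (suc zero) (∀ s → X s → Σ (Dom 𝔐) (F s)) × Sat 𝔐 (supp {𝔐 = 𝔐} X v F) φ
Sat 𝔐 X (all v φ) = Sat 𝔐 (dupl {𝔐 = 𝔐} X v) φ
Sat {𝒟 = 𝒟} 𝔐 X (dep i vs) = Level.Lift (suc zero) (holds (notion 𝒟 i) (Dom 𝔐) (proj {𝔐 = 𝔐} X vs))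
Sat 𝔐 X (box θ _) = Level.Lift (suc zero) (Models 𝔐 θ)

Equivalent : ∀ {L 𝒟 b b'} → Form L 𝒟 b → Form L 𝒟 b' → Set₁
Equivalent {L} φ ψ = (𝔐 : Structure L) (X : Team 𝔐) → Sat 𝔐 X φ ⇔ Sat 𝔐 X ψ

module Submission where

-- The satisfaction of a box [θ] does not depend on the team at all, so a
-- box occurring anywhere in φ — even below a split disjunction or a
-- quantifier — only contributes the global requirement 𝔐 ⊨ θ.  Hence:
--   * `sentences φ` collects the sentences θ of all boxes of φ, and
--   * `matrix φ` replaces every box by the trivial literal x₀ = x₀,
--     which every team satisfies.

open import Defs
open import Data.Bool using (true; false)
open import Data.List using (List; []; _∷_; _++_)
open import Data.List.Relation.Unary.All using (All; []; _∷_)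
open import Data.List.Relation.Unary.All.Properties using (++⁺; ++⁻)
open import Data.Product using (Σ; _×_; _,_; proj₁; uncurry)
open import Function.Bundles using (_⇔_; mk⇔)
open import Function.Properties.Equivalence using () renaming (trans to ⇔-trans; sym to ⇔-sym)
open import Relation.Binary.PropositionalEquality using (refl)
open import Level using (lift; lower)

module _ {L : Signature} {𝒟 : DepFamily} where

  AllModels : Structure L → List (FOSentence L) → Set
  AllModels 𝔐 = All (λ θ → Models 𝔐 (proj₁ θ))

  sentences : ∀ {b} → Form L 𝒟 b → List (FOSentence L)
  sentences (lit α)    = []
  sentences (φ ∧ ψ)    = sentences φ ++ sentences ψ
  sentences (φ ∨ ψ)    = sentences φ ++ sentences ψ
  sentences (ex v φ)   = sentences φ
  sentences (all v φ)  = sentences φ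
  sentences (dep i vs) = []
  sentences (box θ c)  = (θ , c) ∷ []

  trivial : Form L 𝒟 false
  trivial = lit (eq (var 0) (var 0))

  trivial-sat : (𝔐 : Structure L) (X : Team 𝔐) → Sat 𝔐 X (embed trivial)
  trivial-sat 𝔐 X = lift (λ s _ → refl)

  matrix : ∀ {b} → Form L 𝒟 b → Form L 𝒟 false
  matrix (lit α)    = lit α
  matrix (φ ∧ ψ)    = matrix φ ∧ matrix ψ
  matrix (φ ∨ ψ)    = matrix φ ∨ matrix ψ
  matrix (ex v φ)   = ex v (matrix φ)
  matrix (all v φ)  = all v (matrix φ)
  matrix (dep i vs) = dep i vs
  matrix (box θ c)  = trivial

  -- A team satisfying φ witnesses all box sentences and satisfies the
  -- matrix; the same splittings and supplementing functions are reused.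
  split : ∀ {b} 𝔐 (X : Team 𝔐) (φ : Form L 𝒟 b) →
          Sat 𝔐 X φ → AllModels 𝔐 (sentences φ) × Sat 𝔐 X (embed (matrix φ))
  split 𝔐 X (lit α)    h = [] , h
  split 𝔐 X (φ ∧ ψ)    (hφ , hψ) with split 𝔐 X φ hφ | split 𝔐 X ψ hψ
  ... | mφ , sφ | mψ , sψ = ++⁺ mφ mψ , (sφ , sψ)
  split 𝔐 X (φ ∨ ψ)    (Y , Z , X=Y∪Z , hφ , hψ) with split 𝔐 Y φ hφ | split 𝔐 Z ψ hψ
  ... | mφ , sφ | mψ , sψ = ++⁺ mφ mψ , (Y , Z , X=Y∪Z , sφ , sψ)
  split 𝔐 X (ex v φ)   (F , F-total , h) with split 𝔐 _ φ h
  ... | m , s = m , (F , F-total , s)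
  split 𝔐 X (all v φ)  h = split 𝔐 _ φ h
  split 𝔐 X (dep i vs) h = [] , h
  split 𝔐 X (box θ c)  h = lower h ∷ [] , trivial-sat 𝔐 X

  merge : ∀ {b} 𝔐 (X : Team 𝔐) (φ : Form L 𝒟 b) →
          AllModels 𝔐 (sentences φ) → Sat 𝔐 X (embed (matrix φ)) → Sat 𝔐 X φ
  merge 𝔐 X (lit α)    _ h = h
  merge 𝔐 X (φ ∧ ψ)    m (sφ , sψ) with ++⁻ (sentences φ) m
  ... | mφ , mψ = merge 𝔐 X φ mφ sφ , merge 𝔐 X ψ mψ sψ
  merge 𝔐 X (φ ∨ ψ)    m (Y , Z , X=Y∪Z , sφ , sψ) with ++⁻ (sentences φ) m
  ... | mφ , mψ = Y , Z , X=Y∪Z , merge 𝔐 Y φ mφ sφ , merge 𝔐 Z ψ mψ sψ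
  merge 𝔐 X (ex v φ)   m (F , F-total , s) = F , F-total , merge 𝔐 _ φ m s
  merge 𝔐 X (all v φ)  m h = merge 𝔐 _ φ m h
  merge 𝔐 X (dep i vs) _ h = h
  merge 𝔐 X (box θ c)  (M⊨θ ∷ []) _ = lift M⊨θ

  separate : ∀ {b} 𝔐 (X : Team 𝔐) (φ : Form L 𝒟 b) →
             Sat 𝔐 X φ ⇔ (AllModels 𝔐 (sentences φ) × Sat 𝔐 X (embed (matrix φ)))
  separate 𝔐 X φ = mk⇔ (split 𝔐 X φ) (uncurry (merge 𝔐 X φ))

  normalForm-sat : ∀ 𝔐 (X : Team 𝔐) θs (ψ : Form L 𝒟 false) →
                   Sat 𝔐 X (normalForm θs ψ) ⇔ (AllModels 𝔐 θs × Sat 𝔐 X (embed ψ))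
  normalForm-sat 𝔐 X θs ψ = mk⇔ (to θs) (uncurry (from θs))
    where
    to : ∀ θs → Sat 𝔐 X (normalForm θs ψ) → AllModels 𝔐 θs × Sat 𝔐 X (embed ψ)
    to []             h          = [] , h
    to ((θ , c) ∷ θs) (M⊨θ , h) with to θs h
    ... | m , s = lower M⊨θ ∷ m , s

    from : ∀ θs → AllModels 𝔐 θs → Sat 𝔐 X (embed ψ) → Sat 𝔐 X (normalForm θs ψ)
    from []             []        h = h
    from ((θ , c) ∷ θs) (M⊨θ ∷ m) h = lift M⊨θ , from θs m h

mainTheorem15 : (L : Signature) (𝒟 : DepFamily) (φ : Form L 𝒟 true) →
                  Σ (List (FOSentence L)) λ θs →
                    Σ (Form L 𝒟 false) λ ψ →
                      Equivalent φ (normalForm θs ψ)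
mainTheorem15 L 𝒟 φ = sentences φ , matrix φ , λ 𝔐 X →
  ⇔-trans (separate 𝔐 X φ) (⇔-sym (normalForm-sat 𝔐 X (sentences φ) (matrix φ)))
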